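{- Let $G$ be a finite simple connected graph with no induced $P_5$ and no induced $K_{2,3}$, and let $C=v_1v_2v_3v_4v_5v_1$ be an induced 5-cycle of $G$ (indices modulo 5). Let $u,v\in N(C)$. Then: (a) If there is $i$ such that $\{v_i,v_{i+2}\}\subseteq N(u)\cap N(v)$ and $v_{i+1}\notin N(u)\cup N(v)$, then $uv\in E(G)$. (b) For each $1\le i\le 5$, the sets $N_{\{i,i+2\}}(C)$, $N_{\{i,i+1,i+3\}}(C)$ and $N_{\{i,i+1,i+2,i+3\}}(C)$ are cliques. (c) $\alpha(G[N_{\{1,2,3,4,5\}}(C)])\le 2$, and for each $i\in\{1,\dots,5\}$, $\alpha(G[N_{\{i,i+1,i+2\}}(C)])\le 2$ and $N_{\{i,i+1,i+2\}}(C)$ is complete to $N_{\{i+1,i+2,i+3\}}(C)$. (d) If $uv\notin E(G)$ and $\{u,v\}$ is not a bad pair, then $N(u)\cap N(v)\cap N^2(C)=\emptyset$. (e) The set $N(C)\setminus\big(N_{\{1,2,3,4,5\}}(C)\cup\bigcup_{i=1}^5 N_{\{i,i+1,i+2\}}(C)\big)$ can be partitioned into five cliques $S_1,\dots,S_5$ such that $|S_i|\le\omega(G)-1$ and $v_i$ is anticomplete to $S_i$ for each $i$.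
   Context: For $X\subseteq V(G)$, $N^i(X)$ is the set of vertices not in $X$ at distance exactly $i$ from $X$, and $N(X)=N^1(X)$. For $T\subseteq\{1,\dots,5\}$, $N_T(C)$ is the set of vertices $x\in N(C)$ such that $xv_i\in E(G)$ if and only if $i\in T$. A vertex is complete (anticomplete) to a set if it is adjacent to all (none) of its vertices; a set $X$ is complete to $Y$ if every vertex of $X$ is complete to $Y$. Two non-adjacent vertices $u,v\in N(C)$ form a bad pair if there is $i\in\{1,\dots,5\}$ with $u\in N_{\{i,i+1,i+3\}}(C)$ and $v\in N_{\{i,i+1,i+2,i+4\}}(C)$. $\alpha$ is the independence number, $\omega$ the clique number. -}

module Defs where

open import Data.Nat using (ℕ; zero; suc; _≤_; _<_; _∸_)
open import Data.Fin using (Fin; zero; suc; toℕ; _≟_)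
open import Data.Fin.Subset using (Subset; _∈_; ∣_∣)
open import Data.Bool using (Bool; true; false; _∨_; _xor_)
open import Data.List using (List; []; _∷_; length)
import Data.List.Membership.Propositional as LM
open import Data.List.Relation.Unary.All using (All)
open import Data.List.Relation.Unary.AllPairs using (AllPairs)
open import Data.Product using (Σ; ∃; _×_; _,_)
open import Data.Sum using (_⊎_)
open import Relation.Nullary using (¬_)
open import Relation.Nullary.Decidable using (⌊_⌋)
open import Relation.Binary.PropositionalEquality using (_≡_; _≢_)
open import Relation.Binary.Construct.Closure.ReflexiveTransitive using (Star)
open import Function.Definitions using (Injective)

record Graph (n : ℕ) : Set where
  field
    adj    : Fin n → Fin n → Bool
    irrefl : ∀ x → adj x x ≡ false
    sym    : ∀ x y → adj x y ≡ adj y x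
open Graph public

Edge : ∀ {n} → Graph n → Fin n → Fin n → Set
Edge G x y = adj G x y ≡ true

Connected : ∀ {n} → Graph n → Set
Connected G = ∀ x y → Star (Edge G) x y

HasInduced : ∀ {n} → Graph n → (k : ℕ) → (Fin k → Fin k → Bool) → Set
HasInduced {n} G k H =
  Σ (Fin k → Fin n) λ f → Injective _≡_ _≡_ f × (∀ i j → adj G (f i) (f j) ≡ H i j)

absDiff1 : ℕ → ℕ → Bool
absDiff1 zero (suc zero) = true
absDiff1 (suc zero) zero = true
absDiff1 (suc a) (suc b) = absDiff1 a b
absDiff1 _ _ = false

P5 : Fin 5 → Fin 5 → Bool
P5 i j = absDiff1 (toℕ i) (toℕ j)

small : Fin 5 → Bool
small zero = true
small (suc zero) = true
small _ = false

K23 : Fin 5 → Fin 5 → Bool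
K23 i j = small i xor small j

-- Indices modulo 5 (index i of the paper is Fin element i-1)

suc5 : Fin 5 → Fin 5
suc5 zero = suc zero
suc5 (suc zero) = suc (suc zero)
suc5 (suc (suc zero)) = suc (suc (suc zero))
suc5 (suc (suc (suc zero))) = suc (suc (suc (suc zero)))
suc5 (suc (suc (suc (suc zero)))) = zero

_+5_ : Fin 5 → ℕ → Fin 5
i +5 zero = i
i +5 suc k = suc5 (i +5 k)

C5 : Fin 5 → Fin 5 → Bool
C5 i j = ⌊ j ≟ suc5 i ⌋ ∨ ⌊ i ≟ suc5 j ⌋

IsInducedC5 : ∀ {n} → Graph n → (Fin 5 → Fin n) → Set
IsInducedC5 G c = Injective _≡_ _≡_ c × (∀ i j → adj G (c i) (c j) ≡ C5 i j)

module _ {n : ℕ} (G : Graph n) (c : Fin 5 → Fin n) where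

  InC : Fin n → Set
  InC x = ∃ λ i → c i ≡ x

  NC : Fin n → Set
  NC x = ¬ InC x × ∃ λ i → Edge G x (c i)

  N2C : Fin n → Set
  N2C x = ¬ InC x × ¬ NC x × ∃ λ y → NC y × Edge G x y

  NT : List (Fin 5) → Fin n → Set
  NT T x = NC x × (∀ i → (Edge G x (c i) → i LM.∈ T) × (i LM.∈ T → Edge G x (c i)))

  BadPair : Fin n → Fin n → Set
  BadPair u v = adj G u v ≡ false ×
    ∃ λ i → (NT (i ∷ (i +5 1) ∷ (i +5 3) ∷ []) u × NT (i ∷ (i +5 1) ∷ (i +5 2) ∷ (i +5 4) ∷ []) v)
          ⊎ (NT (i ∷ (i +5 1) ∷ (i +5 3) ∷ []) v × NT (i ∷ (i +5 1) ∷ (i +5 2) ∷ (i +5 4) ∷ []) u)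

module _ {n : ℕ} (G : Graph n) where

  IsClique : (Fin n → Set) → Set
  IsClique P = ∀ x y → P x → P y → x ≢ y → Edge G x y

  Complete : (Fin n → Set) → (Fin n → Set) → Set
  Complete P Q = ∀ x y → P x → Q y → Edge G x y

  IsCliqueList : List (Fin n) → Set
  IsCliqueList xs = AllPairs (Edge G) xs

  IsIndepListIn : (Fin n → Set) → List (Fin n) → Set
  IsIndepListIn P xs = All P xs × AllPairs (λ x y → x ≢ y × adj G x y ≡ false) xs

  AlphaLe : (Fin n → Set) → ℕ → Set
  AlphaLe P k = ∀ xs → IsIndepListIn P xs → length xs ≤ k

  IsCliqueNumber : ℕ → Set
  IsCliqueNumber w =
    (∃ λ xs → IsCliqueList xs × length xs ≡ w) × (∀ xs → IsCliqueList xs → length xs ≤ w)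

i0 : Fin 5
i0 = zero

{-# OPTIONS --safe #-}
module Submission where

-- Every claim comes down to an induced P5 or K23 formed by C and at most three further vertices.
-- Two non-adjacent vertices with three pairwise non-adjacent common neighbours span a K23. For the
-- pair v_j, v_{j+2} this gives (a); each type in (b) contains some v_j, v_{j+2} but not v_{j+1},
-- so (b) follows from (a), and the bounds on α in (c) are again this K23. The remaining claims
-- come from induced P5s leaving C along an arc. Which configuration occurs depends only on which
-- cycle vertices each vertex sees, a subset of ℤ/5, and these finitely many case distinctions are
-- settled by evaluating decision procedures. For (e), every remaining vertex sees v_{i-1} and
-- v_{i+1} but not v_i for some i; S_i collects the vertices that choose i, a clique by (a) which
-- v_{i+1} extends, so |S_i| ≤ ω - 1.

open import Defs hiding (sym)
open import Data.Nat using (ℕ; suc; _≤_; _∸_; z≤n; s≤s)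
open import Data.Nat.Properties using (pred[m∸n]≡m∸[1+n]; suc[m]≤n⇒m≤pred[n])
open import Data.Fin using (Fin; zero; suc; _≟_)
open import Data.Fin.Patterns using (0F; 1F; 2F; 3F; 4F)
open import Data.Fin.Properties using (any?; all?)
import Data.Fin.Properties as Fin
open import Data.Fin.Subset using (Subset; _∈_; _∉_; ∣_∣; Nonempty)
open import Data.Fin.Subset.Properties using (_∈?_; nonempty?; anySubset?)
open import Data.Bool using (Bool; true; false)
import Data.Bool.Properties as Bool
open import Data.List using (List; []; _∷_; length; map)
open import Data.List.Properties using (length-map)
import Data.List.Membership.Propositional as List
import Data.List.Membership.DecPropositional as ListDec
open import Data.List.Relation.Unary.All as All using (All; []; _∷_)
import Data.List.Relation.Unary.All.Properties as All
open import Data.List.Relation.Unary.AllPairs using (AllPairs; []; _∷_)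
open import Data.List.Relation.Unary.Unique.Propositional using (Unique)
import Data.List.Relation.Unary.Unique.Propositional.Properties as Unique
open import Data.Maybe using (Maybe; just; nothing)
open import Data.Maybe.Properties using (just-injective)
import Data.Maybe.Properties as Maybe
open import Data.Vec using ([]; _∷_; tabulate; here; there)
open import Data.Vec.Properties using (≡-dec; tabulate-cong; lookup∘tabulate; []=⇒lookup; lookup⇒[]=)
open import Data.Product using (Σ; ∃; _×_; _,_; proj₁; proj₂)
open import Data.Sum using (_⊎_; inj₁; inj₂)
open import Data.Empty using (⊥-elim)
open import Relation.Nullary using (¬_; Dec; does; yes; no; ¬?; _×-dec_; _⊎-dec_; _→-dec_)
open import Relation.Nullary.Decidable using (from-yes; map′; decidable-stable)
open import Relation.Unary using (Pred; Decidable)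
open import Relation.Binary.PropositionalEquality using (_≡_; _≢_; refl; sym; trans; cong; subst)

-- Induced copies of small graphs

module InducedCopies {n : ℕ} (G : Graph n) where

  Apart : Fin n → Fin n → Set
  Apart x y = x ≢ y × adj G x y ≡ false

  Link : Bool → Fin n → Fin n → Set
  Link true  = Edge G
  Link false = Apart

  edge-sym : ∀ {x y} → Edge G x y → Edge G y x
  edge-sym {x} {y} e = trans (Graph.sym G y x) e

  apart-sym : ∀ {x y} → Apart x y → Apart y x
  apart-sym {x} {y} (x≢y , a) = (λ e → x≢y (sym e)) , trans (Graph.sym G y x) a

  link-≢ : ∀ b {x y} → Link b x y → x ≢ y
  link-≢ true  {x} e refl with () ← trans (sym e) (irrefl G x)
  link-≢ false (x≢y , _) = x≢y

  link-adj : ∀ b {x y} → Link b x y → adj G x y ≡ b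
  link-adj true  e       = e
  link-adj false (_ , a) = a

  induced-copy : ∀ {k} (H : Fin k → Fin k → Bool) → (∀ i → H i i ≡ false) → (f : Fin k → Fin n) →
                 (∀ i j → i ≢ j → Link (H i j) (f i) (f j)) → HasInduced G k H
  induced-copy H H-irrefl f link = f , injective , adjacency
    where
    injective : ∀ {i j} → f i ≡ f j → i ≡ j
    injective {i} {j} fi≡fj with i ≟ j
    ... | yes i≡j = i≡j
    ... | no  i≢j = ⊥-elim (link-≢ (H i j) (link i j i≢j) fi≡fj)
    adjacency : ∀ i j → adj G (f i) (f j) ≡ H i j
    adjacency i j with i ≟ j
    ... | yes refl = trans (irrefl G (f i)) (sym (H-irrefl i))
    ... | no  i≢j  = link-adj (H i j) (link i j i≢j)

  induced-P5 : ∀ {a b c d e} → Edge G a b → Edge G b c → Edge G c d → Edge G d e →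
               Apart a c → Apart a d → Apart a e → Apart b d → Apart b e → Apart c e →
               HasInduced G 5 P5
  induced-P5 {a} {b} {c} {d} {e} ab bc cd de ac ad ae bd be ce =
    induced-copy P5 (from-yes (all? λ i → P5 i i Bool.≟ false)) path link
    where
    path : Fin 5 → Fin n
    path 0F = a
    path 1F = b
    path 2F = c
    path 3F = d
    path 4F = e
    link : ∀ i j → i ≢ j → Link (P5 i j) (path i) (path j)
    link 0F 0F ne = ⊥-elim (ne refl)
    link 0F 1F _  = ab
    link 0F 2F _  = ac
    link 0F 3F _  = ad
    link 0F 4F _  = ae
    link 1F 0F _  = edge-sym ab
    link 1F 1F ne = ⊥-elim (ne refl)
    link 1F 2F _  = bc
    link 1F 3F _  = bd
    link 1F 4F _  = be
    link 2F 0F _  = apart-sym ac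
    link 2F 1F _  = edge-sym bc
    link 2F 2F ne = ⊥-elim (ne refl)
    link 2F 3F _  = cd
    link 2F 4F _  = ce
    link 3F 0F _  = apart-sym ad
    link 3F 1F _  = apart-sym bd
    link 3F 2F _  = edge-sym cd
    link 3F 3F ne = ⊥-elim (ne refl)
    link 3F 4F _  = de
    link 4F 0F _  = apart-sym ae
    link 4F 1F _  = apart-sym be
    link 4F 2F _  = apart-sym ce
    link 4F 3F _  = edge-sym de
    link 4F 4F ne = ⊥-elim (ne refl)

  induced-K23 : ∀ {a b x y z} → Edge G a x → Edge G a y → Edge G a z →
                Edge G b x → Edge G b y → Edge G b z →
                Apart a b → Apart x y → Apart x z → Apart y z → HasInduced G 5 K23
  induced-K23 {a} {b} {x} {y} {z} ax ay az bx by bz ab xy xz yz =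
    induced-copy K23 (from-yes (all? λ i → K23 i i Bool.≟ false)) vertex link
    where
    vertex : Fin 5 → Fin n
    vertex 0F = a
    vertex 1F = b
    vertex 2F = x
    vertex 3F = y
    vertex 4F = z
    link : ∀ i j → i ≢ j → Link (K23 i j) (vertex i) (vertex j)
    link 0F 0F ne = ⊥-elim (ne refl)
    link 0F 1F _  = ab
    link 0F 2F _  = ax
    link 0F 3F _  = ay
    link 0F 4F _  = az
    link 1F 0F _  = apart-sym ab
    link 1F 1F ne = ⊥-elim (ne refl)
    link 1F 2F _  = bx
    link 1F 3F _  = by
    link 1F 4F _  = bz
    link 2F 0F _  = edge-sym ax
    link 2F 1F _  = edge-sym bx
    link 2F 2F ne = ⊥-elim (ne refl)
    link 2F 3F _  = xy
    link 2F 4F _  = xz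
    link 3F 0F _  = edge-sym ay
    link 3F 1F _  = edge-sym by
    link 3F 2F _  = apart-sym xy
    link 3F 3F ne = ⊥-elim (ne refl)
    link 3F 4F _  = yz
    link 4F 0F _  = edge-sym az
    link 4F 1F _  = edge-sym bz
    link 4F 2F _  = apart-sym xz
    link 4F 3F _  = apart-sym yz
    link 4F 4F ne = ⊥-elim (ne refl)

-- Finite subsets

module _ {n p} {P : Pred (Fin n) p} (P? : Decidable P) where

  ∈-decided⁺ : ∀ {x} → P x → x ∈ tabulate (λ y → does (P? y))
  ∈-decided⁺ {x} px with P? x in eq
  ... | yes _  = lookup⇒[]= x _ (trans (lookup∘tabulate (λ y → does (P? y)) x) (cong does eq))
  ... | no ¬px = ⊥-elim (¬px px)

  ∈-decided⁻ : ∀ {x} → x ∈ tabulate (λ y → does (P? y)) → P x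
  ∈-decided⁻ {x} x∈ with P? x in eq
  ... | yes px = px
  ... | no  _  with () ← trans (sym (trans (lookup∘tabulate (λ y → does (P? y)) x) (cong does eq)))
                               ([]=⇒lookup x∈)

elements : ∀ {n} → Subset n → List (Fin n)
elements []          = []
elements (true  ∷ p) = zero ∷ map suc (elements p)
elements (false ∷ p) = map suc (elements p)

length-elements : ∀ {n} (p : Subset n) → length (elements p) ≡ ∣ p ∣
length-elements []          = refl
length-elements (true  ∷ p) = cong suc (trans (length-map suc (elements p)) (length-elements p))
length-elements (false ∷ p) = trans (length-map suc (elements p)) (length-elements p)

elements-⊆ : ∀ {n} (p : Subset n) → All (_∈ p) (elements p)
elements-⊆ []          = []
elements-⊆ (true  ∷ p) = here ∷ All.map⁺ (All.map there (elements-⊆ p))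
elements-⊆ (false ∷ p) = All.map⁺ (All.map there (elements-⊆ p))

elements-unique : ∀ {n} (p : Subset n) → Unique (elements p)
elements-unique []          = []
elements-unique (true  ∷ p) = All.map⁺ (All.tabulate λ _ ())
                            ∷ Unique.map⁺ Fin.suc-injective (elements-unique p)
elements-unique (false ∷ p) = Unique.map⁺ Fin.suc-injective (elements-unique p)

all-pairs : ∀ {A : Set} {P : A → Set} {R : A → A → Set} →
            (∀ {x y} → P x → P y → x ≢ y → R x y) →
            ∀ {xs} → All P xs → Unique xs → AllPairs R xs
all-pairs r []         []         = []
all-pairs r (px ∷ pxs) (x∉xs ∷ u) =
  All.zipWith (λ (py , x≢y) → r px py x≢y) (pxs , x∉xs) ∷ all-pairs r pxs u

clique-size : ∀ {n} (G : Graph n) {ω} → IsCliqueNumber G ω → ∀ (p : Subset n) z →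
              IsClique G (_∈ p) → (∀ {x} → x ∈ p → Edge G z x) → ∣ p ∣ ≤ ω ∸ 1
clique-size G {ω} (_ , maximum) p z clique z-complete =
  subst (∣ p ∣ ≤_) (pred[m∸n]≡m∸[1+n] ω 0)
    (suc[m]≤n⇒m≤pred[n] (subst (λ l → suc l ≤ ω) (length-elements p)
                                (maximum (z ∷ elements p) clique-list)))
  where
  clique-list : IsCliqueList G (z ∷ elements p)
  clique-list = All.map z-complete (elements-⊆ p)
              ∷ all-pairs (λ {x} {y} → clique x y) (elements-⊆ p) (elements-unique p)

all-subsets? : ∀ {n p} {P : Pred (Subset n) p} → Decidable P → Dec (∀ s → P s)
all-subsets? P? = map′ (λ ¬∃¬ s → decidable-stable (P? s) (λ ¬p → ¬∃¬ (s , ¬p)))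
                       (λ ∀p (s , ¬p) → ¬p (∀p s))
                       (¬? (anySubset? λ s → ¬? (P? s)))

-- Subsets of ℤ/5

+5-one-injective : ∀ i j → i +5 1 ≡ j +5 1 → i ≡ j
+5-one-injective = from-yes (all? λ i → all? λ j → ((i +5 1) ≟ (j +5 1)) →-dec (i ≟ j))

open ListDec (_≟_ {5}) using () renaming (_∈?_ to _∈ₗ?_)

listed : List (Fin 5) → Subset 5
listed T = tabulate (λ i → does (i ∈ₗ? T))

∈-listed⁺ : ∀ {i T} → i List.∈ T → i ∈ listed T
∈-listed⁺ {T = T} = ∈-decided⁺ (_∈ₗ? T)

∈-listed⁻ : ∀ {i T} → i ∈ listed T → i List.∈ T
∈-listed⁻ {T = T} = ∈-decided⁻ (_∈ₗ? T)

_≟ˢ_ : (s t : Subset 5) → Dec (s ≡ t)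
_≟ˢ_ = ≡-dec Bool._≟_

all-indices : List (Fin 5)
all-indices = i0 ∷ (i0 +5 1) ∷ (i0 +5 2) ∷ (i0 +5 3) ∷ (i0 +5 4) ∷ []

run : Fin 5 → List (Fin 5)
run i = i ∷ (i +5 1) ∷ (i +5 2) ∷ []

bad-sparse bad-dense : Fin 5 → List (Fin 5)
bad-sparse i = i ∷ (i +5 1) ∷ (i +5 3) ∷ []
bad-dense  i = i ∷ (i +5 1) ∷ (i +5 2) ∷ (i +5 4) ∷ []

BadTypes : Subset 5 → Subset 5 → Set
BadTypes s t = ∃ λ i → (s ≡ listed (bad-sparse i) × t ≡ listed (bad-dense i))
                     ⊎ (t ≡ listed (bad-sparse i) × s ≡ listed (bad-dense i))

Straddles : Subset 5 → Fin 5 → Set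
Straddles s j = j ∈ s × (j +5 1) ∉ s × (j +5 2) ∈ s

Pendant₂ : Subset 5 → Fin 5 → Set
Pendant₂ s j = j ∈ s × (j +5 1) ∉ s × (j +5 2) ∉ s

Pendant₃ : Subset 5 → Fin 5 → Set
Pendant₃ s j = Pendant₂ s j × (j +5 3) ∉ s

CommonStraddle : Subset 5 → Subset 5 → Fin 5 → Set
CommonStraddle s t j = (j ∈ s × j ∈ t) × ((j +5 2) ∈ s × (j +5 2) ∈ t)

Crossing : Subset 5 → Subset 5 → Fin 5 → Set
Crossing s t j = (j ∈ t × (j +5 1) ∉ t × (j +5 3) ∉ t) × (j ∉ s × (j +5 1) ∈ s × (j +5 3) ∈ s)

bad? : ∀ s t → Dec (BadTypes s t)
bad? s t = any? λ i → ((s ≟ˢ listed (bad-sparse i)) ×-dec (t ≟ˢ listed (bad-dense i)))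
                    ⊎-dec ((t ≟ˢ listed (bad-sparse i)) ×-dec (s ≟ˢ listed (bad-dense i)))

straddles? : ∀ s j → Dec (Straddles s j)
straddles? s j = (j ∈? s) ×-dec (¬? ((j +5 1) ∈? s) ×-dec ((j +5 2) ∈? s))

pendant₂? : ∀ s j → Dec (Pendant₂ s j)
pendant₂? s j = (j ∈? s) ×-dec (¬? ((j +5 1) ∈? s) ×-dec ¬? ((j +5 2) ∈? s))

pendant₃? : ∀ s j → Dec (Pendant₃ s j)
pendant₃? s j = pendant₂? s j ×-dec ¬? ((j +5 3) ∈? s)

common-straddle? : ∀ s t j → Dec (CommonStraddle s t j)
common-straddle? s t j = ((j ∈? s) ×-dec (j ∈? t)) ×-dec (((j +5 2) ∈? s) ×-dec ((j +5 2) ∈? t))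

crossing? : ∀ s t j → Dec (Crossing s t j)
crossing? s t j = ((j ∈? t) ×-dec (¬? ((j +5 1) ∈? t) ×-dec ¬? ((j +5 3) ∈? t)))
            ×-dec (¬? (j ∈? s) ×-dec (((j +5 1) ∈? s) ×-dec ((j +5 3) ∈? s)))

PairCases : Subset 5 → Subset 5 → Set
PairCases s t = ∃ (Pendant₂ s) ⊎ ∃ (Pendant₂ t) ⊎ ∃ (CommonStraddle s t)
              ⊎ ∃ (Crossing s t) ⊎ ∃ (Crossing t s)

nonbad-pair-cases : ∀ s t → Nonempty s → Nonempty t → ¬ BadTypes s t → PairCases s t
nonbad-pair-cases = from-yes (all-subsets? λ s → all-subsets? λ t →
  nonempty? s →-dec (nonempty? t →-dec (¬? (bad? s t) →-dec
    (any? (pendant₂? s) ⊎-dec any? (pendant₂? t) ⊎-dec any? (common-straddle? s t)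
      ⊎-dec any? (crossing? s t) ⊎-dec any? (crossing? t s)))))

residual-cases : ∀ s → Nonempty s → s ≢ listed all-indices → (∀ i → s ≢ listed (run i)) →
                 ∃ (Straddles s) ⊎ ∃ (Pendant₃ s)
residual-cases = from-yes (all-subsets? λ s →
  nonempty? s →-dec (¬? (s ≟ˢ listed all-indices) →-dec ((all? λ i → ¬? (s ≟ˢ listed (run i))) →-dec
    (any? (straddles? s) ⊎-dec any? (pendant₃? s)))))

no-straddle-all : ∀ j → ¬ Straddles (listed all-indices) j
no-straddle-all = from-yes (all? λ j → ¬? (straddles? (listed all-indices) j))

no-straddle-run : ∀ i j → ¬ Straddles (listed (run i)) j
no-straddle-run = from-yes (all? λ i → all? λ j → ¬? (straddles? (listed (run i)) j))

straddled-types : ∀ i → ∃ (Straddles (listed (i ∷ (i +5 2) ∷ [])))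
                      × ∃ (Straddles (listed (i ∷ (i +5 1) ∷ (i +5 3) ∷ [])))
                      × ∃ (Straddles (listed (i ∷ (i +5 1) ∷ (i +5 2) ∷ (i +5 3) ∷ [])))
straddled-types = from-yes (all? λ i → any? (straddles? (listed (i ∷ (i +5 2) ∷ [])))
  ×-dec any? (straddles? (listed (i ∷ (i +5 1) ∷ (i +5 3) ∷ [])))
  ×-dec any? (straddles? (listed (i ∷ (i +5 1) ∷ (i +5 2) ∷ (i +5 3) ∷ []))))

all-indices-profile : 0F ∈ listed all-indices × 2F ∈ listed all-indices
all-indices-profile = from-yes ((0F ∈? listed all-indices) ×-dec (2F ∈? listed all-indices))

run-profile : ∀ i → (i ∈ listed (run i) × (i +5 2) ∈ listed (run i) × (i +5 4) ∉ listed (run i))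
                  × ((i +5 2) ∈ listed (run (i +5 1)) × i ∉ listed (run (i +5 1))
                                                       × (i +5 4) ∉ listed (run (i +5 1)))
run-profile = from-yes (all? λ i →
  ((i ∈? listed (run i)) ×-dec ((i +5 2) ∈? listed (run i)) ×-dec ¬? ((i +5 4) ∈? listed (run i)))
  ×-dec (((i +5 2) ∈? listed (run (i +5 1))) ×-dec ¬? (i ∈? listed (run (i +5 1)))
           ×-dec ¬? ((i +5 4) ∈? listed (run (i +5 1)))))

gap : Subset 5 → Maybe (Fin 5)
gap s with any? (straddles? s)
... | yes (j , _) = just (j +5 1)
... | no  _       = nothing

gap-straddles : ∀ {s i} → gap s ≡ just i → ∃ λ j → Straddles s j × j +5 1 ≡ i
gap-straddles {s} eq with any? (straddles? s)
... | yes (j , st) = j , st , just-injective eq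
... | no  _        with () ← eq

straddles⇒gap : ∀ {s j} → Straddles s j → ∃ λ i → gap s ≡ just i
straddles⇒gap {s} st with any? (straddles? s)
... | yes (j , _) = j +5 1 , refl
... | no  ¬st     = ⊥-elim (¬st (_ , st))

-- Vertices around the cycle

module Neighbourhood {n : ℕ} (G : Graph n) (c : Fin 5 → Fin n) where

  open InducedCopies G

  -- For x ∈ N(C) this is the set T with x ∈ N_T(C).
  type : Fin n → Subset 5
  type x = tabulate (λ i → adj G x (c i))

  ∈-type⁺ : ∀ {x i} → Edge G x (c i) → i ∈ type x
  ∈-type⁺ {x} {i} e = lookup⇒[]= i (type x) (trans (lookup∘tabulate (λ k → adj G x (c k)) i) e)

  ∈-type⁻ : ∀ {x i} → i ∈ type x → Edge G x (c i)
  ∈-type⁻ {x} {i} i∈ = trans (sym (lookup∘tabulate (λ k → adj G x (c k)) i)) ([]=⇒lookup i∈)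

  ∉-type⁻ : ∀ {x i} → i ∉ type x → adj G x (c i) ≡ false
  ∉-type⁻ i∉ = Bool.¬-not (λ e → i∉ (∈-type⁺ e))

  NC⇒nonempty : ∀ {x} → NC G c x → Nonempty (type x)
  NC⇒nonempty (_ , i , e) = i , ∈-type⁺ e

  NT⇒type : ∀ {T x} → NT G c T x → type x ≡ listed T
  NT⇒type {T} {x} (_ , h) = tabulate-cong pointwise
    where
    pointwise : ∀ i → adj G x (c i) ≡ does (i ∈ₗ? T)
    pointwise i with i ∈ₗ? T
    ... | yes i∈T = proj₂ (h i) i∈T
    ... | no  i∉T = Bool.¬-not (λ e → i∉T (proj₁ (h i) e))

  type⇒NT : ∀ {T x} → NC G c x → type x ≡ listed T → NT G c T x
  type⇒NT {T} {x} nc t = nc , λ i →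
    (λ e → ∈-listed⁻ (subst (i ∈_) t (∈-type⁺ e))) ,
    (λ i∈T → ∈-type⁻ (subst (i ∈_) (sym t) (∈-listed⁺ i∈T)))

  apart-off-cycle : ∀ {x j} → ¬ InC G c x → adj G x (c j) ≡ false → Apart x (c j)
  apart-off-cycle {j = j} x∉C a = (λ e → x∉C (j , sym e)) , a

  apart-far : ∀ {w} → ¬ InC G c w → ¬ NC G c w → ∀ j → Apart w (c j)
  apart-far w∉C w∉NC j = apart-off-cycle w∉C (Bool.¬-not (λ e → w∉NC (w∉C , j , e)))

  InC? : ∀ x → Dec (InC G c x)
  InC? x = any? λ i → c i ≟ x

  GapAt : Fin 5 → Fin n → Set
  GapAt i x = ¬ InC G c x × gap (type x) ≡ just i

  gap-at? : ∀ i x → Dec (GapAt i x)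
  gap-at? i x = ¬? (InC? x) ×-dec Maybe.≡-dec _≟_ (gap (type x)) (just i)

  gap-class : Fin 5 → Subset n
  gap-class i = tabulate (λ x → does (gap-at? i x))

  gap-class-straddles : ∀ {i x} → x ∈ gap-class i →
                        ¬ InC G c x × ∃ λ j → Straddles (type x) j × j +5 1 ≡ i
  gap-class-straddles {i} x∈ with ∈-decided⁻ (gap-at? i) x∈
  ... | x∉C , eq = x∉C , gap-straddles eq

module Cycle {n : ℕ} (G : Graph n) (c : Fin 5 → Fin n) (hc : IsInducedC5 G c) where

  open InducedCopies G

  private
    edge-on-cycle : ∀ {i j} → C5 i j ≡ true → Edge G (c i) (c j)
    edge-on-cycle {i} {j} e = trans (proj₂ hc i j) e

    apart-on-cycle : ∀ {i j} → i ≢ j × C5 i j ≡ false → Apart (c i) (c j)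
    apart-on-cycle {i} {j} (i≢j , a) = (λ e → i≢j (proj₁ hc e)) , trans (proj₂ hc i j) a

  cycle-edge : ∀ i → Edge G (c i) (c (i +5 1))
  cycle-edge i = edge-on-cycle (from-yes (all? λ i → C5 i (i +5 1) Bool.≟ true) i)

  cycle-edge⁻ : ∀ i → Edge G (c i) (c (i +5 4))
  cycle-edge⁻ i = edge-on-cycle (from-yes (all? λ i → C5 i (i +5 4) Bool.≟ true) i)

  cycle-apart₂ : ∀ i → Apart (c i) (c (i +5 2))
  cycle-apart₂ i =
    apart-on-cycle (from-yes (all? λ i → ¬? (i ≟ (i +5 2)) ×-dec (C5 i (i +5 2) Bool.≟ false)) i)

  cycle-apart₃ : ∀ i → Apart (c i) (c (i +5 3))
  cycle-apart₃ i =
    apart-on-cycle (from-yes (all? λ i → ¬? (i ≟ (i +5 3)) ×-dec (C5 i (i +5 3) Bool.≟ false)) i)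

module Lemma4p1 {n : ℕ} (G : Graph n) (c : Fin 5 → Fin n) (hc : IsInducedC5 G c)
                (P5-free : ¬ HasInduced G 5 P5) (K23-free : ¬ HasInduced G 5 K23) where

  open InducedCopies G
  open Neighbourhood G c
  open Cycle G c hc

  NT-edge : ∀ {T x i} → NT G c T x → i ∈ listed T → Edge G x (c i)
  NT-edge (_ , h) i∈ = proj₂ (h _) (∈-listed⁻ i∈)

  NT-apart : ∀ {T x i} → NT G c T x → i ∉ listed T → Apart x (c i)
  NT-apart (nc , h) i∉ =
    apart-off-cycle (proj₁ nc) (Bool.¬-not (λ e → i∉ (∈-listed⁺ (proj₁ (h _) e))))

  straddled-pair-adjacent : ∀ u v → NC G c u → NC G c v → u ≢ v → ∀ i →
    Edge G u (c i) → Edge G v (c i) → Edge G u (c (i +5 2)) → Edge G v (c (i +5 2)) →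
    adj G u (c (i +5 1)) ≡ false → adj G v (c (i +5 1)) ≡ false → Edge G u v
  straddled-pair-adjacent u v (u∉C , _) (v∉C , _) u≢v i ui vi uk vk um vm with adj G u v in uv
  ... | true  = refl
  ... | false = ⊥-elim (K23-free (induced-K23
        (cycle-edge i) (edge-sym ui) (edge-sym vi)
        (edge-sym (cycle-edge (i +5 1))) (edge-sym uk) (edge-sym vk)
        (cycle-apart₂ i) (apart-sym (apart-off-cycle u∉C um)) (apart-sym (apart-off-cycle v∉C vm))
        (u≢v , uv)))

  straddle-adjacent : ∀ {u v j} → NC G c u → NC G c v → u ≢ v →
                      Straddles (type u) j → Straddles (type v) j → Edge G u v
  straddle-adjacent {u} {v} {j} nu nv u≢v (uj , um , uk) (vj , vm , vk) =
    straddled-pair-adjacent u v nu nv u≢v j (∈-type⁻ uj) (∈-type⁻ vj) (∈-type⁻ uk) (∈-type⁻ vk)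
      (∉-type⁻ um) (∉-type⁻ vm)

  straddled-type-clique : ∀ {T} → ∃ (Straddles (listed T)) → IsClique G (NT G c T)
  straddled-type-clique {T} (j , st) x y tx ty x≢y =
    straddle-adjacent (proj₁ tx) (proj₁ ty) x≢y (along tx) (along ty)
    where
    along : ∀ {z} → NT G c T z → Straddles (type z) j
    along tz = subst (λ s → Straddles s j) (sym (NT⇒type tz)) st

  no-independent-triple : ∀ {T j} → j ∈ listed T → (j +5 2) ∈ listed T → AlphaLe G (NT G c T) 2
  no-independent-triple _ _ []                _ = z≤n
  no-independent-triple _ _ (_ ∷ [])          _ = s≤s z≤n
  no-independent-triple _ _ (_ ∷ _ ∷ [])      _ = s≤s (s≤s z≤n)
  no-independent-triple {T} {j} j∈ k∈ (_ ∷ _ ∷ _ ∷ _)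
                        (tx ∷ ty ∷ tz ∷ _ , (xy ∷ xz ∷ _) ∷ (yz ∷ _) ∷ _) =
    ⊥-elim (K23-free (induced-K23 (to tx j∈) (to ty j∈) (to tz j∈) (to tx k∈) (to ty k∈) (to tz k∈)
                                  (cycle-apart₂ j) xy xz yz))
    where
    to : ∀ {w i} → NT G c T w → i ∈ listed T → Edge G (c i) w
    to tw i∈ = edge-sym (NT-edge tw i∈)

  -- Otherwise y v_{i+2} x v_i v_{i+4} is an induced path.
  runs-complete : ∀ i → Complete G (NT G c (run i)) (NT G c (run (i +5 1)))
  runs-complete i x y tx ty with run-profile i | adj G x y in xy
  ... | _ | true = refl
  ... | (xi , xk , x4) , (yk , yi , y4) | false =
    ⊥-elim (P5-free (induced-P5 (NT-edge ty yk) (edge-sym (NT-edge tx xk)) (NT-edge tx xi) (cycle-edge⁻ i)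
                                (apart-sym (x≢y , xy)) (NT-apart ty yi) (NT-apart ty y4)
                                (apart-sym (cycle-apart₂ i)) (cycle-apart₂ (i +5 2)) (NT-apart tx x4)))
    where
    x≢y : x ≢ y
    x≢y refl with () ← trans (sym (NT-edge tx xi)) (proj₂ (NT-apart ty yi))

  BadTypes⇒BadPair : ∀ {u v} → NC G c u → NC G c v → adj G u v ≡ false →
                     BadTypes (type u) (type v) → BadPair G c u v
  BadTypes⇒BadPair nu nv uv (i , inj₁ (su , sv)) = uv , i , inj₁ (type⇒NT nu su , type⇒NT nv sv)
  BadTypes⇒BadPair nu nv uv (i , inj₂ (sv , su)) = uv , i , inj₂ (type⇒NT nv sv , type⇒NT nu su)

  pendant-P5 : ∀ {w x j} → ¬ InC G c w → ¬ NC G c w → ¬ InC G c x → Edge G x w →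
               Pendant₂ (type x) j → HasInduced G 5 P5
  pendant-P5 {w} {x} {j} w∉C w∉NC x∉C xw (xj , x1 , x2) =
    induced-P5 (edge-sym xw) (∈-type⁻ xj) (cycle-edge j) (cycle-edge (j +5 1))
               (far j) (far (j +5 1)) (far (j +5 2))
               (apart-off-cycle x∉C (∉-type⁻ x1)) (apart-off-cycle x∉C (∉-type⁻ x2)) (cycle-apart₂ j)
    where
    far : ∀ j → Apart w (c j)
    far = apart-far w∉C w∉NC

  -- The induced path is v v_j v_{j+1} u v_{j+3}.
  crossing-P5 : ∀ {u v j} → ¬ InC G c u → ¬ InC G c v → Apart u v →
                Crossing (type u) (type v) j → HasInduced G 5 P5
  crossing-P5 {u} {v} {j} u∉C v∉C uv ((vj , v1 , v3) , (u0 , u1 , u3)) =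
    induced-P5 (∈-type⁻ vj) (cycle-edge j) (edge-sym (∈-type⁻ u1)) (∈-type⁻ u3)
               (apart-off-cycle v∉C (∉-type⁻ v1)) (apart-sym uv) (apart-off-cycle v∉C (∉-type⁻ v3))
               (apart-sym (apart-off-cycle u∉C (∉-type⁻ u0))) (cycle-apart₃ j) (cycle-apart₂ (j +5 1))

  common-straddle-K23 : ∀ {u v w j} → ¬ InC G c w → ¬ NC G c w → Edge G u w → Edge G v w → Apart u v →
                        CommonStraddle (type u) (type v) j → HasInduced G 5 K23
  common-straddle-K23 {w = w} {j} w∉C w∉NC uw vw uv ((uj , vj) , (uk , vk)) =
    induced-K23 uw (∈-type⁻ uj) (∈-type⁻ uk) vw (∈-type⁻ vj) (∈-type⁻ vk)
                uv (far j) (far (j +5 2)) (cycle-apart₂ j)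
    where
    far : ∀ j → Apart w (c j)
    far = apart-far w∉C w∉NC

  no-common-second-neighbour : ∀ u v → NC G c u → NC G c v → u ≢ v → adj G u v ≡ false →
                               ¬ BadPair G c u v → ∀ w → Edge G u w → Edge G v w → ¬ N2C G c w
  no-common-second-neighbour u v nu@(u∉C , _) nv@(v∉C , _) u≢v uv ¬bad w uw vw (w∉C , w∉NC , _) =
    impossible (nonbad-pair-cases (type u) (type v) (NC⇒nonempty nu) (NC⇒nonempty nv)
                                  (λ b → ¬bad (BadTypes⇒BadPair nu nv uv b)))
    where
    impossible : ¬ PairCases (type u) (type v)
    impossible (inj₁ (_ , p))                      = P5-free (pendant-P5 w∉C w∉NC u∉C uw p)
    impossible (inj₂ (inj₁ (_ , p)))               = P5-free (pendant-P5 w∉C w∉NC v∉C vw p)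
    impossible (inj₂ (inj₂ (inj₁ (_ , p))))        = K23-free (common-straddle-K23 w∉C w∉NC uw vw (u≢v , uv) p)
    impossible (inj₂ (inj₂ (inj₂ (inj₁ (_ , p))))) = P5-free (crossing-P5 u∉C v∉C (u≢v , uv) p)
    impossible (inj₂ (inj₂ (inj₂ (inj₂ (_ , p))))) = P5-free (crossing-P5 v∉C u∉C (apart-sym (u≢v , uv)) p)

  Residual : Fin n → Set
  Residual x = NC G c x × ¬ NT G c all-indices x × (∀ i → ¬ NT G c (run i) x)

  arc-P5 : ∀ {x j} → ¬ InC G c x → Pendant₃ (type x) j → HasInduced G 5 P5
  arc-P5 {x} {j} x∉C ((xj , x1 , x2) , x3) =
    induced-P5 (∈-type⁻ xj) (cycle-edge j) (cycle-edge (j +5 1)) (cycle-edge (j +5 2))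
               (apart-off-cycle x∉C (∉-type⁻ x1)) (apart-off-cycle x∉C (∉-type⁻ x2))
               (apart-off-cycle x∉C (∉-type⁻ x3)) (cycle-apart₂ j) (cycle-apart₃ j) (cycle-apart₂ (j +5 1))

  residual-covered : ∀ x → Residual x → ∃ λ i → x ∈ gap-class i
  residual-covered x (nc , ¬all , ¬run) =
    covered (residual-cases (type x) (NC⇒nonempty nc) (λ e → ¬all (type⇒NT nc e))
                            (λ i e → ¬run i (type⇒NT nc e)))
    where
    covered : ∃ (Straddles (type x)) ⊎ ∃ (Pendant₃ (type x)) → ∃ λ i → x ∈ gap-class i
    covered (inj₁ (_ , st)) with straddles⇒gap st
    ... | i , eq = i , ∈-decided⁺ (gap-at? i) (proj₁ nc , eq)
    covered (inj₂ (_ , p)) = ⊥-elim (P5-free (arc-P5 (proj₁ nc) p))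

  gap-class-residual : ∀ x i → x ∈ gap-class i → Residual x
  gap-class-residual x i x∈ with gap-class-straddles x∈
  ... | x∉C , j , st , _ = (x∉C , j , ∈-type⁻ (proj₁ st)) ,
                           (λ t → no-straddle-all j (subst (λ s → Straddles s j) (NT⇒type t) st)) ,
                           (λ k t → no-straddle-run k j (subst (λ s → Straddles s j) (NT⇒type t) st))

  gap-classes-disjoint : ∀ x i j → x ∈ gap-class i → x ∈ gap-class j → i ≡ j
  gap-classes-disjoint x i j x∈i x∈j =
    just-injective (trans (sym (proj₂ (∈-decided⁻ (gap-at? i) x∈i)))
                          (proj₂ (∈-decided⁻ (gap-at? j) x∈j)))

  gap-class-clique : ∀ i → IsClique G (_∈ gap-class i)
  gap-class-clique i x y x∈ y∈ x≢y with gap-class-straddles x∈ | gap-class-straddles y∈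
  ... | _ , j , sx , ex | _ , j′ , sy , ey with +5-one-injective j′ j (trans ey (sym ex))
  ... | refl = straddle-adjacent (proj₁ (gap-class-residual x i x∈)) (proj₁ (gap-class-residual y i y∈))
                                 x≢y sx sy

  gap-class-anticomplete : ∀ i x → x ∈ gap-class i → adj G x (c i) ≡ false
  gap-class-anticomplete i x x∈ with gap-class-straddles x∈
  ... | _ , j , (_ , xm , _) , eq = subst (λ k → adj G x (c k) ≡ false) eq (∉-type⁻ xm)

  gap-class-size : ∀ {ω} → IsCliqueNumber G ω → ∀ i → ∣ gap-class i ∣ ≤ ω ∸ 1
  gap-class-size hω i = clique-size G hω (gap-class i) (c (i +5 1)) (gap-class-clique i) complete
    where
    complete : ∀ {x} → x ∈ gap-class i → Edge G (c (i +5 1)) x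
    complete {x} x∈ with gap-class-straddles x∈
    ... | _ , j , (_ , _ , xk) , eq = subst (λ k → Edge G (c (k +5 1)) x) eq (edge-sym (∈-type⁻ xk))

lemma4p1 : ∀ {n} (G : Graph n) (c : Fin 5 → Fin n) →
  Connected G → ¬ HasInduced G 5 P5 → ¬ HasInduced G 5 K23 → IsInducedC5 G c →
  -- (a)
  (∀ u v → NC G c u → NC G c v → u ≢ v → ∀ i →
    Edge G u (c i) → Edge G v (c i) → Edge G u (c (i +5 2)) → Edge G v (c (i +5 2)) →
    adj G u (c (i +5 1)) ≡ false → adj G v (c (i +5 1)) ≡ false → Edge G u v)
  -- (b)
  × (∀ i → IsClique G (NT G c (i ∷ (i +5 2) ∷ []))
         × IsClique G (NT G c (i ∷ (i +5 1) ∷ (i +5 3) ∷ []))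
         × IsClique G (NT G c (i ∷ (i +5 1) ∷ (i +5 2) ∷ (i +5 3) ∷ [])))
  -- (c)
  × (AlphaLe G (NT G c (i0 ∷ (i0 +5 1) ∷ (i0 +5 2) ∷ (i0 +5 3) ∷ (i0 +5 4) ∷ [])) 2
     × (∀ i → AlphaLe G (NT G c (i ∷ (i +5 1) ∷ (i +5 2) ∷ [])) 2
            × Complete G (NT G c (i ∷ (i +5 1) ∷ (i +5 2) ∷ []))
                         (NT G c ((i +5 1) ∷ (i +5 2) ∷ (i +5 3) ∷ []))))
  -- (d)
  × (∀ u v → NC G c u → NC G c v → u ≢ v → adj G u v ≡ false → ¬ BadPair G c u v →
      ∀ w → Edge G u w → Edge G v w → ¬ N2C G c w)
  -- (e)
  × (∀ ω → IsCliqueNumber G ω →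
      Σ (Fin 5 → Subset n) λ S →
        (∀ x → (NC G c x
                 × ¬ NT G c (i0 ∷ (i0 +5 1) ∷ (i0 +5 2) ∷ (i0 +5 3) ∷ (i0 +5 4) ∷ []) x
                 × (∀ i → ¬ NT G c (i ∷ (i +5 1) ∷ (i +5 2) ∷ []) x))
               → ∃ λ i → x ∈ S i)
        × (∀ x i → x ∈ S i → NC G c x
                 × ¬ NT G c (i0 ∷ (i0 +5 1) ∷ (i0 +5 2) ∷ (i0 +5 3) ∷ (i0 +5 4) ∷ []) x
                 × (∀ j → ¬ NT G c (j ∷ (j +5 1) ∷ (j +5 2) ∷ []) x))
        × (∀ x i j → x ∈ S i → x ∈ S j → i ≡ j)
        × (∀ i → IsClique G (λ x → x ∈ S i)
               × ∣ S i ∣ ≤ ω ∸ 1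
               × (∀ x → x ∈ S i → adj G x (c i) ≡ false)))
lemma4p1 G c _ P5-free K23-free hc =
  straddled-pair-adjacent ,
  (λ i → let (b₁ , b₂ , b₃) = straddled-types i
         in straddled-type-clique b₁ , straddled-type-clique b₂ , straddled-type-clique b₃) ,
  (no-independent-triple (proj₁ all-indices-profile) (proj₂ all-indices-profile) ,
   λ i → let ((i∈ , k∈ , _) , _) = run-profile i in no-independent-triple i∈ k∈ , runs-complete i) ,
  no-common-second-neighbour ,
  λ ω hω → gap-class , residual-covered , gap-class-residual , gap-classes-disjoint ,
           λ i → gap-class-clique i , gap-class-size hω i , gap-class-anticomplete i
  where
  open Neighbourhood G c
  open Lemma4p1 G c hc P5-free K23-free
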